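{- Every integer $n > 1$ with $F_n = D_n$ is a prime power pseudoperfect number, i.e. \[ \sum_{p^k \mid n} \frac{1}{p^k} + \frac{1}{n} = 1, \] where the sum runs over all prime powers $p^k$ (with $p$ prime and $k \geq 1$) dividing $n$.
   Context: For a composite positive integer $m$, let $d(m)$ denote the largest divisor of $m$ strictly between $1$ and $m$. Define $f$ on integers $m > 1$ by $f(m) = m - 1$ if $m$ is prime and $f(m) = m - d(m)$ if $m$ is composite. Let $f^{(0)}(n) = n$ and $f^{(i)} = f \circ f^{(i-1)}$. For an integer $n>1$, let $F_n = \{n, f(n), f^{(2)}(n), \dots, 1\}$ be the set of values obtained by iterating $f$ from $n$ until $1$ is reached. Let $D_n$ denote the set of all positive divisors of $n$. A prime power pseudoperfect number is an integer $n > 1$ satisfying $\sum_{p^k \mid n} \frac{1}{p^k} + \frac{1}{n} = 1$, the sum taken over all prime power divisors $p^k$ ($k\ge 1$) of $n$. -}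

module Defs where

open import Data.Nat using (ℕ; zero; suc; _∸_; _^_; _<_; _≤_)
open import Data.Nat.Divisibility using (_∣_; _∣?_)
open import Data.Nat.Primality using (prime?)
open import Data.Bool using (Bool; true; false; if_then_else_; _∧_)
open import Data.List using (List; map; upTo; concatMap; foldr)
open import Data.Integer using (+_)
open import Data.Rational using (ℚ; _/_; _+_; 0ℚ)
open import Relation.Nullary.Decidable using (⌊_⌋)

largestDivBelow : ℕ → ℕ → ℕ
largestDivBelow zero          m = 1
largestDivBelow (suc zero)    m = 1
largestDivBelow (suc (suc j)) m =
  if ⌊ suc (suc j) ∣? m ⌋ then suc (suc j) else largestDivBelow (suc j) m

-- d(m): largest divisor of m strictly between 1 and m (meaningful for composite m).
d : ℕ → ℕ
d m = largestDivBelow (m ∸ 1) m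

f : ℕ → ℕ
f m = if ⌊ prime? m ⌋ then m ∸ 1 else m ∸ d m

iter : ℕ → ℕ → ℕ
iter zero    m = m
iter (suc i) m = f (iter i m)

-- m ∈ F_n : m = f^(i)(n) for some i such that all earlier iterates are > 1
-- (i.e. the iteration is stopped once 1 is reached).
_∈F_ : ℕ → ℕ → Set
m ∈F n = Data.Product.Σ ℕ (λ i → (iter i n ≡ m) Data.Product.× (∀ j → j < i → 1 < iter j n))
  where open import Data.Product
        open import Relation.Binary.PropositionalEquality using (_≡_)

-- 1/q as a rational (q = 0 gives 0; never used with q = 0 below)
inv : ℕ → ℚ
inv zero    = 0ℚ
inv (suc q) = + 1 / suc q

-- ∑ over prime powers p^k ∣ n (p prime, k ≥ 1) of 1/p^k.
-- Every such p^k has p ≤ n and 1 ≤ k ≤ n, and (p,k) is determined by p^k.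
primePowerRecipSum : ℕ → ℚ
primePowerRecipSum n =
  foldr _+_ 0ℚ
    (concatMap (λ p → map (λ k →
        if ⌊ prime? p ⌋ ∧ ⌊ p ^ suc k ∣? n ⌋ then inv (p ^ suc k) else 0ℚ)
      (upTo n))
    (upTo (suc n)))

PPPseudoperfect : ℕ → Set
PPPseudoperfect n = (1 < n) × (primePowerRecipSum n + inv n ≡ + 1 / 1)
  where open import Data.Product using (_×_)
        open import Relation.Binary.PropositionalEquality using (_≡_)

module Submission where

-- Let q be the largest prime factor of n and write n = q^(c+1)·m with q ∤ m.  The largest proper
-- divisor d(y) of y is y divided by the least prime factor of y, and every prime factor of m is at
-- most q; hence f(q^(c+1)·y) = q^(c+1)·f(y) for every divisor y > 1 of m, and the orbit of n is
-- q^(c+1) times the orbit of m until it reaches q^(c+1), after which it continues with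
-- f(q^(c+1)) = (q-1)·q^c.  So F_n = D_n forces F_m = D_m, and comparing the places of (q-1)·q^c and
-- q^c·m in the orbit forces q = m + 1.  By induction on n the identity holds for m, and it lifts to
-- n because the prime powers of n are those of m together with q, …, q^(c+1), and for q = m + 1
--   1/q + … + 1/q^(c+1) + 1/(q^(c+1)·m) = 1/m.

open import Defs
open import Algebra.Bundles using (CommutativeMonoid)
import Algebra.Properties.CommutativeSemigroup as CommutativeSemigroupProperties
open import Data.Bool using (if_then_else_; _∧_)
open import Data.Integer as ℤ using ()
open import Data.List using (List; []; _∷_; _++_; [_]; map; upTo; concatMap; foldr)
open import Data.List.Membership.Propositional using (_∈_)
open import Data.List.Properties using (map-++; upTo-∷ʳ)
open import Data.List.Relation.Unary.All as All using (_∷_)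
open import Data.List.Relation.Unary.Any using (here; there)
open import Data.Nat as ℕ
  using (ℕ; zero; suc; _∸_; _*_; _^_; _<_; _≤_; z≤n; s≤s; NonZero; NonTrivial)
open import Data.Nat.Coprimality as Coprime using (Coprime)
open import Data.Nat.Divisibility
open import Data.Nat.Induction using (<-rec)
open import Data.Nat.ListAction.Properties using (∈⇒∣product)
open import Data.Nat.Primality
open import Data.Nat.Primality.Factorisation using (factorise; factorisationHasAllPrimeFactors)
import Data.Nat.Properties as ℕ
open import Data.Nat.Properties using (≤-totalOrder)
open import Data.List.Extrema ≤-totalOrder using (max; argmax-all; xs≤max; v≤max⁺)
open import Data.Nat.Solver using (module +-*-Solver)
open import Data.Product using (∃-syntax; _×_; _,_; proj₁; proj₂)
open import Data.Rational using (ℚ; 0ℚ; 1ℚ; _+_; toℚᵘ)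
open import Data.Rational.Properties
  using (+-identityˡ; +-identityʳ; +-assoc; +-0-commutativeMonoid;
         toℚᵘ-injective; toℚᵘ-homo-+; toℚᵘ-fromℚᵘ)
import Data.Rational.Unnormalised as ℚᵘ
import Data.Rational.Unnormalised.Properties as ℚᵘ
open import Data.Sum using (inj₁; inj₂; _⊎_; [_,_]′)
open import Function using (id; _∘_; _∘′_)
open import Function.Bundles using (_⇔_; mk⇔; Equivalence)
open import Relation.Binary.PropositionalEquality
  using (_≡_; _≢_; refl; sym; trans; cong; cong₂; subst; subst₂; module ≡-Reasoning)
open import Relation.Nullary using (¬_; yes; no; contradiction)
open import Relation.Nullary.Decidable using (⌊_⌋)

module ℕ* = CommutativeSemigroupProperties ℕ.*-commutativeSemigroup
module ℚ+ = CommutativeSemigroupProperties (CommutativeMonoid.commutativeSemigroup +-0-commutativeMonoid)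

-- Finite sums of rationals

sumℚ : List ℚ → ℚ
sumℚ = foldr _+_ 0ℚ

∑< : ℕ → (ℕ → ℚ) → ℚ
∑< zero    g = 0ℚ
∑< (suc B) g = ∑< B g + g B

syntax ∑< B (λ k → e) = ∑[ k < B ] e

sumℚ-++ : ∀ xs ys → sumℚ (xs ++ ys) ≡ sumℚ xs + sumℚ ys
sumℚ-++ []       ys = sym (+-identityˡ _)
sumℚ-++ (x ∷ xs) ys = trans (cong (x +_) (sumℚ-++ xs ys)) (sym (+-assoc x _ _))

sumℚ-concatMap : ∀ {A : Set} (g : A → List ℚ) xs →
                 sumℚ (concatMap g xs) ≡ sumℚ (map (λ a → sumℚ (g a)) xs)
sumℚ-concatMap g []       = refl
sumℚ-concatMap g (x ∷ xs) = trans (sumℚ-++ (g x) _) (cong (sumℚ (g x) +_) (sumℚ-concatMap g xs))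

sumℚ-map-upTo : ∀ (g : ℕ → ℚ) B → sumℚ (map g (upTo B)) ≡ ∑< B g
sumℚ-map-upTo g zero    = refl
sumℚ-map-upTo g (suc B) = begin
  sumℚ (map g (upTo (suc B)))         ≡⟨ cong (sumℚ ∘′ map g) (upTo-∷ʳ B) ⟨
  sumℚ (map g (upTo B ++ [ B ]))       ≡⟨ cong sumℚ (map-++ g (upTo B) [ B ]) ⟩
  sumℚ (map g (upTo B) ++ [ g B ])     ≡⟨ sumℚ-++ (map g (upTo B)) [ g B ] ⟩
  sumℚ (map g (upTo B)) + (g B + 0ℚ)   ≡⟨ cong₂ _+_ (sumℚ-map-upTo g B) (+-identityʳ (g B)) ⟩
  ∑< B g + g B                         ∎
  where open ≡-Reasoning

∑<-cong : ∀ {g h} B → (∀ {k} → k < B → g k ≡ h k) → ∑< B g ≡ ∑< B h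
∑<-cong zero    eq = refl
∑<-cong (suc B) eq = cong₂ _+_ (∑<-cong B (eq ∘ ℕ.m<n⇒m<1+n)) (eq ℕ.≤-refl)

∑<-zero : ∀ {g} B → (∀ {k} → k < B → g k ≡ 0ℚ) → ∑< B g ≡ 0ℚ
∑<-zero zero    eq = refl
∑<-zero (suc B) eq = trans (cong₂ _+_ (∑<-zero B (eq ∘ ℕ.m<n⇒m<1+n)) (eq ℕ.≤-refl)) (+-identityʳ 0ℚ)

∑<-distrib-+ : ∀ (g h : ℕ → ℚ) B → ∑[ k < B ] (g k + h k) ≡ ∑< B g + ∑< B h
∑<-distrib-+ g h zero    = refl
∑<-distrib-+ g h (suc B) = begin
  ∑[ k < B ] (g k + h k) + (g B + h B)  ≡⟨ cong (_+ (g B + h B)) (∑<-distrib-+ g h B) ⟩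
  (∑< B g + ∑< B h) + (g B + h B)       ≡⟨ ℚ+.interchange (∑< B g) (∑< B h) (g B) (h B) ⟩
  (∑< B g + g B) + (∑< B h + h B)       ∎
  where open ≡-Reasoning

∑<-extend : ∀ {g} B C → B ≤ C → (∀ {k} → B ≤ k → g k ≡ 0ℚ) → ∑< C g ≡ ∑< B g
∑<-extend _ zero    z≤n _      = refl
∑<-extend B (suc C) B≤C vanish with ℕ.m≤n⇒m<n∨m≡n B≤C
... | inj₂ refl      = refl
... | inj₁ (s≤s B≤C) = trans (cong₂ _+_ (∑<-extend B C B≤C vanish) (vanish B≤C)) (+-identityʳ _)

∑<-single : ∀ {g} B y → y < B → (∀ {k} → k ≢ y → g k ≡ 0ℚ) → ∑< B g ≡ g y
∑<-single {g} B y y<B vanish = begin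
  ∑< B g         ≡⟨ ∑<-extend (suc y) B y<B (vanish ∘ ℕ.>⇒≢) ⟩
  ∑< y g + g y   ≡⟨ cong (_+ g y) (∑<-zero y (vanish ∘ ℕ.<⇒≢)) ⟩
  0ℚ + g y       ≡⟨ +-identityˡ (g y) ⟩
  g y            ∎
  where open ≡-Reasoning

-- Prime factors and prime powers

1<⇒nonZero : ∀ {n} → 1 < n → NonZero n
1<⇒nonZero {suc _} _ = _

∣⇒nonZero : ∀ {m n} .{{_ : NonZero n}} → m ∣ n → NonZero m
∣⇒nonZero {zero}  {n} 0∣n = contradiction (0∣⇒≡0 0∣n) (ℕ.≢-nonZero⁻¹ n)
∣⇒nonZero {suc m}     _   = _

prime⇒1< : ∀ {p} → Prime p → 1 < p
prime⇒1< {p} pP = ℕ.nonTrivial⇒n>1 p {{prime⇒nonTrivial pP}}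

largestPrimeFactor : ∀ n .{{_ : NonZero n}} → 1 < n →
                     ∃[ q ] Prime q × q ∣ n × (∀ {p} → Prime p → p ∣ n → p ≤ q)
largestPrimeFactor n 1<n with factorise n
... | record { factors = [] ; isFactorisation = n≡1 } = contradiction n≡1 (ℕ.>⇒≢ 1<n)
... | record { factors = p ∷ ps ; isFactorisation = n≡Π ; factorsPrime = pP ∷ psP } =
  max p ps , proj₁ maxFactor , proj₂ maxFactor , bound
  where
  factor : ∀ {x} → x ∈ p ∷ ps → Prime x × x ∣ n
  factor x∈ = All.lookup (pP ∷ psP) x∈ , subst (_ ∣_) (sym n≡Π) (∈⇒∣product x∈)
  maxFactor : Prime (max p ps) × max p ps ∣ n
  maxFactor = argmax-all id (factor (here refl)) (All.tabulate (factor ∘ there))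
  bound : ∀ {r} → Prime r → r ∣ n → r ≤ max p ps
  bound rP r∣n with factorisationHasAllPrimeFactors rP (subst (_ ∣_) n≡Π r∣n) (pP ∷ psP)
  ... | here refl  = v≤max⁺ p ps (inj₁ ℕ.≤-refl)
  ... | there r∈ps = All.lookup (xs≤max p ps) r∈ps

factorOut : ∀ {q} → Prime q → ∀ n .{{_ : NonZero n}} → ∃[ c ] ∃[ m ] n ≡ q ^ c * m × ¬ q ∣ m
factorOut {q} qP = <-rec Split go
  where
  Split : ℕ → Set
  Split n = .{{_ : NonZero n}} → ∃[ c ] ∃[ m ] n ≡ q ^ c * m × ¬ q ∣ m
  go : ∀ n → (∀ {k} → k < n → Split k) → Split n
  go n rec with q ∣? n
  ... | no q∤n  = 0 , n , sym (ℕ.*-identityˡ n) , q∤n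
  ... | yes q∣n with rec (quotient-< q∣n {{prime⇒nonTrivial qP}}) {{quotient≢0 q∣n}}
  ...   | c , m , n/q≡q^c*m , q∤m = suc c , m , n≡q^[1+c]*m , q∤m
    where
    n≡q^[1+c]*m : n ≡ q ^ suc c * m
    n≡q^[1+c]*m = trans (m∣n⇒n≡m*quotient q∣n)
                        (trans (cong (q *_) n/q≡q^c*m) (sym (ℕ.*-assoc q (q ^ c) m)))

k<p^k : ∀ {p} → 1 < p → ∀ k → k < p ^ k
k<p^k 1<p zero    = ℕ.z<s
k<p^k 1<p (suc k) = ℕ.≤-<-trans (k<p^k 1<p k) (ℕ.^-monoʳ-< _ 1<p (ℕ.n<1+n k))

p≤p^[1+k] : ∀ p .{{_ : NonZero p}} k → p ≤ p ^ suc k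
p≤p^[1+k] p k = ℕ.m≤m*n p (p ^ k) {{ℕ.m^n≢0 p k}}

1<prime^[1+c] : ∀ {q} c → Prime q → 1 < q ^ suc c
1<prime^[1+c] {q} c qP = ℕ.<-≤-trans (prime⇒1< qP) (p≤p^[1+k] q {{prime⇒nonZero qP}} c)

^-monoʳ-∣ : ∀ q {j c} → j ≤ c → q ^ j ∣ q ^ c
^-monoʳ-∣ q {c = c} z≤n       = 1∣ (q ^ c)
^-monoʳ-∣ q         (s≤s j≤c) = *-monoʳ-∣ q (^-monoʳ-∣ q j≤c)

prime∣prime^⇒≡ : ∀ {p q} c → Prime p → Prime q → p ∣ q ^ c → p ≡ q
prime∣prime^⇒≡ zero    pP qP p∣1 = contradiction (subst Prime (∣1⇒≡1 p∣1) pP) ¬prime[1]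
prime∣prime^⇒≡ {q = q} (suc c) pP qP p∣q^[1+c] with euclidsLemma q (q ^ c) pP p∣q^[1+c]
... | inj₂ p∣q^c = prime∣prime^⇒≡ c pP qP p∣q^c
... | inj₁ p∣q with prime⇒irreducible qP p∣q
...   | inj₁ refl = contradiction pP ¬prime[1]
...   | inj₂ p≡q  = p≡q

prime^∣prime^⇒≡∧< : ∀ {p q k} c → Prime p → Prime q → p ^ suc k ∣ q ^ c → p ≡ q × k < c
prime^∣prime^⇒≡∧< {p} {q} {k} c pP qP p^[1+k]∣q^c
  with prime∣prime^⇒≡ c pP qP (∣-trans (m∣m*n (p ^ k)) p^[1+k]∣q^c)
... | refl = refl , ℕ.≮⇒≥ (λ c<1+k → ℕ.<⇒≱ (ℕ.^-monoʳ-< q (prime⇒1< qP) c<1+k) q^[1+k]≤q^c)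
  where
  q^[1+k]≤q^c : q ^ suc k ≤ q ^ c
  q^[1+k]≤q^c = ∣⇒≤ {{ℕ.m^n≢0 q c {{prime⇒nonZero qP}}}} p^[1+k]∣q^c

prime^∣*⇒∣ : ∀ {p a b} → Prime p → ¬ p ∣ b → ∀ j → p ^ j ∣ a * b → p ^ j ∣ a
prime^∣*⇒∣ pP p∤b zero _ = 1∣ _
prime^∣*⇒∣ {p} {a} {b} pP p∤b (suc j) p^[1+j]∣ab
  with prime^∣*⇒∣ pP p∤b j (∣-trans (n∣m*n p) p^[1+j]∣ab)
... | divides a′ a≡a′p^j with euclidsLemma a′ b pP p∣a′b
  where
  p∣a′b : p ∣ a′ * b
  p∣a′b = *-cancelʳ-∣ (p ^ j) {{ℕ.m^n≢0 p j {{prime⇒nonZero pP}}}}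
            (subst (p ^ suc j ∣_) (trans (cong (_* b) a≡a′p^j) (ℕ*.xy∙z≈xz∙y a′ (p ^ j) b)) p^[1+j]∣ab)
... | inj₁ p∣a′ = subst (_ ∣_) (sym a≡a′p^j) (*-monoˡ-∣ (p ^ j) p∣a′)
... | inj₂ p∣b  = contradiction p∣b p∤b

coprime∧prime∣⇒∤ : ∀ {p a b} → Coprime a b → Prime p → p ∣ a → ¬ p ∣ b
coprime∧prime∣⇒∤ a⊥b pP p∣a p∣b = ¬prime[1] (subst Prime (a⊥b (p∣a , p∣b)) pP)

prime^∣*⇒∣⊎∣ : ∀ {p a b} k → Prime p → Coprime a b → p ^ suc k ∣ a * b →
                p ^ suc k ∣ a ⊎ p ^ suc k ∣ b
prime^∣*⇒∣⊎∣ {p} {a} {b} k pP a⊥b p^[1+k]∣ab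
  with euclidsLemma a b pP (∣-trans (m∣m*n (p ^ k)) p^[1+k]∣ab)
... | inj₁ p∣a = inj₁ (prime^∣*⇒∣ pP (coprime∧prime∣⇒∤ a⊥b pP p∣a) (suc k) p^[1+k]∣ab)
... | inj₂ p∣b = inj₂ (prime^∣*⇒∣ pP (coprime∧prime∣⇒∤ (Coprime.sym a⊥b) pP p∣b) (suc k)
                                  (subst (p ^ suc k ∣_) (ℕ.*-comm a b) p^[1+k]∣ab))

prime^-coprime : ∀ {q m} c .{{_ : NonZero m}} → Prime q → ¬ q ∣ m → Coprime (q ^ c) m
prime^-coprime {m = m} c qP q∤m {zero}            (_ , 0∣m) = contradiction (0∣⇒≡0 0∣m) (ℕ.≢-nonZero⁻¹ m)
prime^-coprime         c qP q∤m {suc zero}        _         = refl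
prime^-coprime         c qP q∤m {d@(suc (suc _))} (d∣q^c , d∣m)
  with largestPrimeFactor d (s≤s (s≤s z≤n))
... | p , pP , p∣d , _ with prime∣prime^⇒≡ c pP qP (∣-trans p∣d d∣q^c)
...   | refl = contradiction (∣-trans p∣d d∣m) q∤m

-- The sum over prime powers

primePowerTerm : ℕ → ℕ → ℕ → ℚ
primePowerTerm n p k = if ⌊ prime? p ⌋ ∧ ⌊ p ^ suc k ∣? n ⌋ then inv (p ^ suc k) else 0ℚ

primePowerRecipSum≡∑∑ : ∀ n → primePowerRecipSum n ≡ ∑[ p < suc n ] ∑[ k < n ] primePowerTerm n p k
primePowerRecipSum≡∑∑ n = begin
  primePowerRecipSum n
    ≡⟨ sumℚ-concatMap (λ p → map (primePowerTerm n p) (upTo n)) (upTo (suc n)) ⟩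
  sumℚ (map (λ p → sumℚ (map (primePowerTerm n p) (upTo n))) (upTo (suc n)))
    ≡⟨ sumℚ-map-upTo _ (suc n) ⟩
  ∑[ p < suc n ] sumℚ (map (primePowerTerm n p) (upTo n))
    ≡⟨ ∑<-cong (suc n) (λ {p} _ → sumℚ-map-upTo (primePowerTerm n p) n) ⟩
  ∑[ p < suc n ] ∑[ k < n ] primePowerTerm n p k
    ∎
  where open ≡-Reasoning

primePowerTerm-vanishes : ∀ {n} p k .{{_ : NonZero n}} → n < p ⊎ n ≤ k → primePowerTerm n p k ≡ 0ℚ
primePowerTerm-vanishes {n} p k out-of-range with prime? p
... | no _ = refl
... | yes pP with p ^ suc k ∣? n
...   | no _          = refl
...   | yes p^[1+k]∣n = contradiction (∣⇒≤ p^[1+k]∣n) (too-large out-of-range)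
  where
  too-large : n < p ⊎ n ≤ k → ¬ p ^ suc k ≤ n
  too-large (inj₁ n<p) p^[1+k]≤n =
    ℕ.<⇒≱ n<p (ℕ.≤-trans (p≤p^[1+k] p {{prime⇒nonZero pP}} k) p^[1+k]≤n)
  too-large (inj₂ n≤k) p^[1+k]≤n =
    ℕ.≤⇒≯ n≤k (ℕ.≤-trans (ℕ.<⇒≤ (k<p^k (prime⇒1< pP) (suc k))) p^[1+k]≤n)

primePowerTerm-* : ∀ {a b} p k → Coprime a b →
                   primePowerTerm (a * b) p k ≡ primePowerTerm a p k + primePowerTerm b p k
primePowerTerm-* {a} {b} p k a⊥b with prime? p
... | no _   = refl
... | yes pP with p ^ suc k ∣? a * b | p ^ suc k ∣? a | p ^ suc k ∣? b
...   | yes _     | yes p^∣a | yes p^∣b =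
  contradiction (∣-trans (m∣m*n (p ^ k)) p^∣b) (coprime∧prime∣⇒∤ a⊥b pP (∣-trans (m∣m*n (p ^ k)) p^∣a))
...   | yes _     | yes _    | no _     = sym (+-identityʳ _)
...   | yes _     | no _     | yes _    = sym (+-identityˡ _)
...   | yes p^∣ab | no p^∤a  | no p^∤b  =
  contradiction (prime^∣*⇒∣⊎∣ k pP a⊥b p^∣ab) [ p^∤a , p^∤b ]′
...   | no p^∤ab  | yes p^∣a | _        = contradiction (∣m⇒∣m*n b p^∣a) p^∤ab
...   | no p^∤ab  | no _     | yes p^∣b = contradiction (∣n⇒∣m*n a p^∣b) p^∤ab
...   | no _      | no _     | no _     = refl

primePowerTerm-prime^-vanishes : ∀ {q} p k c → Prime q → p ≢ q ⊎ c ≤ k → primePowerTerm (q ^ c) p k ≡ 0ℚ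
primePowerTerm-prime^-vanishes {q} p k c qP off-support with prime? p
... | no _   = refl
... | yes pP with p ^ suc k ∣? q ^ c
...   | no _ = refl
...   | yes p^[1+k]∣q^c with prime^∣prime^⇒≡∧< c pP qP p^[1+k]∣q^c | off-support
...     | p≡q , _   | inj₁ p≢q = contradiction p≡q p≢q
...     | _   , k<c | inj₂ c≤k = contradiction k<c (ℕ.≤⇒≯ c≤k)

primePowerTerm-prime^ : ∀ {q k c} → Prime q → k < c → primePowerTerm (q ^ c) q k ≡ inv (q ^ suc k)
primePowerTerm-prime^ {q} {k} {c} qP k<c with prime? q
... | no ¬qP = contradiction qP ¬qP
... | yes _ with q ^ suc k ∣? q ^ c
...   | yes _          = refl
...   | no q^[1+k]∤q^c = contradiction (^-monoʳ-∣ q k<c) q^[1+k]∤q^c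

primePowerRecipSum-range : ∀ n .{{_ : NonZero n}} N → n ≤ N →
                           primePowerRecipSum n ≡ ∑[ p < suc N ] ∑[ k < N ] primePowerTerm n p k
primePowerRecipSum-range n N n≤N = sym (begin
  ∑[ p < suc N ] ∑[ k < N ] primePowerTerm n p k
    ≡⟨ ∑<-cong (suc N) (λ {p} _ → ∑<-extend n N n≤N λ {k} n≤k →
         primePowerTerm-vanishes p k (inj₂ n≤k)) ⟩
  ∑[ p < suc N ] ∑[ k < n ] primePowerTerm n p k
    ≡⟨ ∑<-extend (suc n) (suc N) (s≤s n≤N) (λ {p} n<p → ∑<-zero n λ {k} _ →
         primePowerTerm-vanishes p k (inj₁ n<p)) ⟩
  ∑[ p < suc n ] ∑[ k < n ] primePowerTerm n p k
    ≡⟨ primePowerRecipSum≡∑∑ n ⟨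
  primePowerRecipSum n
    ∎)
  where open ≡-Reasoning

primePowerRecipSum-* : ∀ a b .{{_ : NonZero a}} .{{_ : NonZero b}} → Coprime a b →
                       primePowerRecipSum (a * b) ≡ primePowerRecipSum a + primePowerRecipSum b
primePowerRecipSum-* a b a⊥b = begin
  primePowerRecipSum (a * b)
    ≡⟨ primePowerRecipSum-range (a * b) {{ℕ.m*n≢0 a b}} N ℕ.≤-refl ⟩
  ∑[ p < suc N ] ∑[ k < N ] primePowerTerm (a * b) p k
    ≡⟨ ∑<-cong (suc N) (λ {p} _ → ∑<-cong N (λ {k} _ → primePowerTerm-* p k a⊥b)) ⟩
  ∑[ p < suc N ] ∑[ k < N ] (primePowerTerm a p k + primePowerTerm b p k)
    ≡⟨ ∑<-cong (suc N) (λ {p} _ → ∑<-distrib-+ (primePowerTerm a p) (primePowerTerm b p) N) ⟩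
  ∑[ p < suc N ] (∑[ k < N ] primePowerTerm a p k + ∑[ k < N ] primePowerTerm b p k)
    ≡⟨ ∑<-distrib-+ _ _ (suc N) ⟩
  ∑[ p < suc N ] ∑[ k < N ] primePowerTerm a p k + ∑[ p < suc N ] ∑[ k < N ] primePowerTerm b p k
    ≡⟨ cong₂ _+_ (primePowerRecipSum-range a N (ℕ.m≤m*n a b))
                 (primePowerRecipSum-range b N (ℕ.m≤n*m b a)) ⟨
  primePowerRecipSum a + primePowerRecipSum b
    ∎
  where
  open ≡-Reasoning
  N = a * b

primePowerRecipSum-prime^ : ∀ {q} c → Prime q → primePowerRecipSum (q ^ c) ≡ ∑[ k < c ] inv (q ^ suc k)
primePowerRecipSum-prime^         zero     qP = refl
primePowerRecipSum-prime^ {q} (suc c′) qP = begin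
  primePowerRecipSum (q ^ c)
    ≡⟨ primePowerRecipSum-range (q ^ c) N ℕ.≤-refl ⟩
  ∑[ p < suc N ] ∑[ k < N ] primePowerTerm (q ^ c) p k
    ≡⟨ ∑<-single (suc N) q (s≤s (p≤p^[1+k] q c′)) (λ {p} p≢q → ∑<-zero N λ {k} _ →
         primePowerTerm-prime^-vanishes p k c qP (inj₁ p≢q)) ⟩
  ∑[ k < N ] primePowerTerm (q ^ c) q k
    ≡⟨ ∑<-extend c N (ℕ.<⇒≤ (k<p^k (prime⇒1< qP) c)) (λ {k} c≤k →
         primePowerTerm-prime^-vanishes q k c qP (inj₂ c≤k)) ⟩
  ∑[ k < c ] primePowerTerm (q ^ c) q k
    ≡⟨ ∑<-cong c (primePowerTerm-prime^ qP) ⟩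
  ∑[ k < c ] inv (q ^ suc k)
    ∎
  where
  open ≡-Reasoning
  c = suc c′
  N = q ^ c
  instance
    _ = prime⇒nonZero qP
    _ = ℕ.m^n≢0 q c

inv-+ : ∀ a b c .{{_ : NonZero a}} .{{_ : NonZero b}} .{{_ : NonZero c}} →
        (a ℕ.+ b) * c ≡ a * b → inv a + inv b ≡ inv c
inv-+ (suc a) (suc b) (suc c) eq = toℚᵘ-injective (begin
  toℚᵘ (inv (suc a) + inv (suc b))
    ≈⟨ toℚᵘ-homo-+ (inv (suc a)) (inv (suc b)) ⟩
  toℚᵘ (inv (suc a)) ℚᵘ.+ toℚᵘ (inv (suc b))
    ≈⟨ ℚᵘ.+-cong (toℚᵘ-fromℚᵘ 1/[1+a]) (toℚᵘ-fromℚᵘ 1/[1+b]) ⟩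
  1/[1+a] ℚᵘ.+ 1/[1+b]
    ≈⟨ ℚᵘ.*≡* (cong ℤ.+_ cross-multiplied) ⟩
  1/[1+c]
    ≈⟨ toℚᵘ-fromℚᵘ 1/[1+c] ⟨
  toℚᵘ (inv (suc c))
    ∎)
  where
  open ℚᵘ.≃-Reasoning
  1/[1+a] = ℚᵘ.mkℚᵘ (ℤ.+ 1) a
  1/[1+b] = ℚᵘ.mkℚᵘ (ℤ.+ 1) b
  1/[1+c] = ℚᵘ.mkℚᵘ (ℤ.+ 1) c
  cross-multiplied : (1 * suc b ℕ.+ 1 * suc a) * suc c ≡ 1 * (suc a * suc b)
  cross-multiplied =
    trans (cong (_* suc c) (trans (ℕ.+-comm (1 * suc b) (1 * suc a))
                                  (cong₂ ℕ._+_ (ℕ.*-identityˡ (suc a)) (ℕ.*-identityˡ (suc b)))))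
          (trans eq (sym (ℕ.*-identityˡ (suc a * suc b))))

∑inv-geometric : ∀ m .{{_ : NonZero m}} c → ∑[ k < c ] inv (suc m ^ suc k) + inv (suc m ^ c * m) ≡ inv m
∑inv-geometric m zero    = trans (+-identityˡ _) (cong inv (ℕ.*-identityˡ m))
∑inv-geometric m (suc c) = begin
  (∑[ k < c ] inv (q ^ suc k) + inv (q * X)) + inv (q * X * m)
    ≡⟨ +-assoc (∑[ k < c ] inv (q ^ suc k)) _ _ ⟩
  ∑[ k < c ] inv (q ^ suc k) + (inv (q * X) + inv (q * X * m))
    ≡⟨ cong (∑[ k < c ] inv (q ^ suc k) +_) (inv-+ (q * X) (q * X * m) (X * m) (cross-multiplied X m)) ⟩
  ∑[ k < c ] inv (q ^ suc k) + inv (X * m)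
    ≡⟨ ∑inv-geometric m c ⟩
  inv m
    ∎
  where
  open ≡-Reasoning
  q = suc m
  X = q ^ c
  instance
    _ = ℕ.m^n≢0 q c
    _ = ℕ.m*n≢0 q X
    _ = ℕ.m*n≢0 (q * X) m
    _ = ℕ.m*n≢0 X m
  cross-multiplied : ∀ X m → (suc m * X ℕ.+ suc m * X * m) * (X * m) ≡ suc m * X * (suc m * X * m)
  cross-multiplied = solve 2 (λ X m → ((con 1 :+ m) :* X :+ (con 1 :+ m) :* X :* m) :* (X :* m)
                                   := (con 1 :+ m) :* X :* ((con 1 :+ m) :* X :* m)) refl
    where open +-*-Solver

-- The largest proper divisor and the map f

largestDivBelow-∣ : ∀ k m → largestDivBelow k m ∣ m
largestDivBelow-∣ zero          m = 1∣ m
largestDivBelow-∣ (suc zero)    m = 1∣ m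
largestDivBelow-∣ (suc (suc k)) m with suc (suc k) ∣? m | largestDivBelow-∣ (suc k) m
... | yes k∣m | _  = k∣m
... | no  _   | ih = ih

largestDivBelow-≤ : ∀ k m → 1 ≤ k → largestDivBelow k m ≤ k
largestDivBelow-≤ (suc zero)    m _ = ℕ.≤-refl
largestDivBelow-≤ (suc (suc k)) m _ with suc (suc k) ∣? m | largestDivBelow-≤ (suc k) m (s≤s z≤n)
... | yes _ | _  = ℕ.≤-refl
... | no  _ | ih = ℕ.m≤n⇒m≤1+n ih

largestDivBelow-maximal : ∀ k m {j} → 1 < j → j ≤ k → j ∣ m → j ≤ largestDivBelow k m
largestDivBelow-maximal zero          m (s≤s (s≤s _)) () _
largestDivBelow-maximal (suc zero)    m (s≤s (s≤s _)) (s≤s ()) _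
largestDivBelow-maximal (suc (suc k)) m {j} 1<j j≤k j∣m
  with suc (suc k) ∣? m | largestDivBelow-maximal (suc k) m 1<j
... | yes _   | _  = j≤k
... | no  k∤m | ih with ℕ.m≤n⇒m<n∨m≡n j≤k
...   | inj₁ (s≤s j≤1+k) = ih j≤1+k j∣m
...   | inj₂ refl        = contradiction j∣m k∤m

record LargestProperDivisor (y r : ℕ) : Set where
  field
    r∣y     : r ∣ y
    r<y     : r < y
    maximal : ∀ {j} → j ∣ y → j < y → j ≤ r

open LargestProperDivisor

largestProperDivisor-unique : ∀ {y r r′} → LargestProperDivisor y r → LargestProperDivisor y r′ → r ≡ r′
largestProperDivisor-unique R R′ = ℕ.≤-antisym (maximal R′ (r∣y R) (r<y R)) (maximal R (r∣y R′) (r<y R′))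

d-largestProperDivisor : ∀ {y} → 1 < y → LargestProperDivisor y (d y)
d-largestProperDivisor {suc zero}    (s≤s ())
d-largestProperDivisor {suc (suc y)} _ = record
  { r∣y     = dy∣y
  ; r<y     = s≤s (largestDivBelow-≤ (suc y) (suc (suc y)) (s≤s z≤n))
  ; maximal = maximal′
  }
  where
  dy∣y = largestDivBelow-∣ (suc y) (suc (suc y))
  maximal′ : ∀ {j} → j ∣ suc (suc y) → j < suc (suc y) → j ≤ d (suc (suc y))
  maximal′ {zero}        0∣y _         = contradiction (0∣⇒≡0 0∣y) λ ()
  maximal′ {suc zero}    _   _         = ℕ.>-nonZero⁻¹ _ {{∣⇒nonZero dy∣y}}
  maximal′ {suc (suc j)} j∣y (s≤s j≤y) =
    largestDivBelow-maximal (suc y) (suc (suc y)) (s≤s (s≤s z≤n)) j≤y j∣y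

d-nonZero : ∀ {y} → 1 < y → NonZero (d y)
d-nonZero 1<y = ∣⇒nonZero {{1<⇒nonZero 1<y}} (r∣y (d-largestProperDivisor 1<y))

record LeastPrimeFactor (y s : ℕ) : Set where
  field
    isPrime : Prime s
    s∣y     : s ∣ y
    least   : ∀ {p} → Prime p → p ∣ y → s ≤ p

open LeastPrimeFactor

leastPrimeFactor⇒largestProperDivisor : ∀ {y s r} .{{_ : NonZero r}} → LeastPrimeFactor y s → y ≡ s * r →
                                        LargestProperDivisor y r
leastPrimeFactor⇒largestProperDivisor {y} {s} {r} S refl = record
  { r∣y     = n∣m*n s
  ; r<y     = subst (r <_) (ℕ.*-comm r s) (ℕ.m<m*n r s (prime⇒1< (isPrime S)))
  ; maximal = maximal′
  }
  where
  instance
    _ = prime⇒nonZero (isPrime S)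
    _ = ℕ.m*n≢0 s r
  -- s·r = t·j, and a prime factor of the cofactor t > 1 is at least s.
  maximal′ : ∀ {j} → j ∣ s * r → j < s * r → j ≤ r
  maximal′ {j} j∣y j<y with largestPrimeFactor (quotient j∣y) {{quotient≢0 j∣y}} (quotient>1 j∣y j<y)
  ... | p , pP , p∣t , _ = ℕ.*-cancelˡ-≤ s (begin
    s * j   ≤⟨ ℕ.*-monoˡ-≤ j (ℕ.≤-trans s≤p p≤t) ⟩
    t * j   ≡⟨ m∣n⇒n≡quotient*m j∣y ⟨
    s * r   ∎)
    where
    open ℕ.≤-Reasoning
    t = quotient j∣y
    s≤p = least S pP (∣-trans p∣t (quotient-∣ j∣y))
    p≤t = ∣⇒≤ {{quotient≢0 j∣y}} p∣t

largestProperDivisor⇒leastPrimeFactor : ∀ {y r} .{{_ : NonZero y}} → LargestProperDivisor y r →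
                                        ∃[ s ] LeastPrimeFactor y s × y ≡ s * r
largestProperDivisor⇒leastPrimeFactor {y} {r} R = s , S , y≡s*r
  where
  s = quotient (r∣y R)
  y≡s*r = m∣n⇒n≡quotient*m (r∣y R)
  instance
    _ : NonZero r
    _ = ∣⇒nonZero (r∣y R)
    _ : NonTrivial s
    _ = ℕ.n>1⇒nonTrivial (quotient>1 (r∣y R) (r<y R))
  s-prime : Prime s
  s-prime = prime λ (hasNonTrivialDivisor {a} a<s a∣s) →
    ℕ.<⇒≱ (ℕ.nonTrivial⇒n>1 a)
      (ℕ.*-cancelʳ-≤ a 1 r (subst (a * r ≤_) (sym (ℕ.*-identityˡ r))
        (maximal R (subst (a * r ∣_) (sym y≡s*r) (*-monoˡ-∣ r a∣s))
                   (subst (a * r <_) (sym y≡s*r) (ℕ.*-monoˡ-< r a<s)))))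
  s-least : ∀ {p} → Prime p → p ∣ y → s ≤ p
  s-least {p} pP p∣y = ℕ.*-cancelʳ-≤ s p r (begin
    s * r              ≡⟨ y≡s*r ⟨
    y                  ≡⟨ m∣n⇒n≡m*quotient p∣y ⟩
    p * quotient p∣y   ≤⟨ ℕ.*-monoʳ-≤ p (maximal R (quotient-∣ p∣y) p∣y-cofactor<y) ⟩
    p * r              ∎)
    where
    open ℕ.≤-Reasoning
    p∣y-cofactor<y = quotient-< p∣y {{prime⇒nonTrivial pP}}
  S : LeastPrimeFactor y s
  S = record { isPrime = s-prime ; s∣y = quotient-∣ (r∣y R) ; least = s-least }

leastPrimeFactor-prime^ : ∀ {q} c → Prime q → LeastPrimeFactor (q ^ suc c) q
leastPrimeFactor-prime^ {q} c qP = record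
  { isPrime = qP
  ; s∣y     = m∣m*n (q ^ c)
  ; least   = λ pP p∣q^[1+c] → ℕ.≤-reflexive (sym (prime∣prime^⇒≡ (suc c) pP qP p∣q^[1+c]))
  }

d-prime^ : ∀ {q} c → Prime q → d (q ^ suc c) ≡ q ^ c
d-prime^ {q} c qP = largestProperDivisor-unique (d-largestProperDivisor (1<prime^[1+c] c qP))
  (leastPrimeFactor⇒largestProperDivisor {{ℕ.m^n≢0 q c {{prime⇒nonZero qP}}}} (leastPrimeFactor-prime^ c qP) refl)

d-prime : ∀ {p} → Prime p → d p ≡ 1
d-prime {p} pP = subst (λ y → d y ≡ 1) (ℕ.*-identityʳ p) (d-prime^ 0 pP)

f≡∸d : ∀ {y} → 1 < y → f y ≡ y ∸ d y
f≡∸d {y} 1<y with prime? y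
... | yes yP = cong (y ∸_) (sym (d-prime yP))
... | no _   = refl

PrimeFactorsBelow : ℕ → ℕ → Set
PrimeFactorsBelow x a = ∀ {p s} → Prime p → Prime s → p ∣ a → s ∣ x → s ≤ p

-- Multiplying x by a keeps the least prime factor s of x least, so d (a·x) = a·x/s = a·d x.
d-* : ∀ a {x} .{{_ : NonZero a}} → 1 < x → PrimeFactorsBelow x a → d (a * x) ≡ a * d x
d-* a {x} 1<x a-primes-above
  with largestProperDivisor⇒leastPrimeFactor {{1<⇒nonZero 1<x}} (d-largestProperDivisor 1<x)
... | s , S , x≡s*dx = largestProperDivisor-unique (d-largestProperDivisor (ℕ.<-≤-trans 1<x (ℕ.m≤n*m x a)))
  (leastPrimeFactor⇒largestProperDivisor {{ℕ.m*n≢0 a (d x)}} S′ ax≡s*[a*dx])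
  where
  instance _ = d-nonZero 1<x
  ax≡s*[a*dx] : a * x ≡ s * (a * d x)
  ax≡s*[a*dx] = trans (cong (a *_) x≡s*dx) (ℕ*.x∙yz≈y∙xz a s (d x))
  S′ : LeastPrimeFactor (a * x) s
  S′ = record
    { isPrime = isPrime S
    ; s∣y     = ∣n⇒∣m*n a (s∣y S)
    ; least   = λ pP p∣ax → [ (λ p∣a → a-primes-above pP (isPrime S) p∣a (s∣y S)) , least S pP ]′
                                (euclidsLemma a x pP p∣ax)
    }

f-* : ∀ a {x} .{{_ : NonZero a}} → 1 < x → PrimeFactorsBelow x a → f (a * x) ≡ a * f x
f-* a {x} 1<x a-primes-above = begin
  f (a * x)          ≡⟨ f≡∸d (ℕ.<-≤-trans 1<x (ℕ.m≤n*m x a)) ⟩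
  a * x ∸ d (a * x)  ≡⟨ cong (a * x ∸_) (d-* a 1<x a-primes-above) ⟩
  a * x ∸ a * d x    ≡⟨ ℕ.*-distribˡ-∸ a x (d x) ⟨
  a * (x ∸ d x)      ≡⟨ cong (a *_) (f≡∸d 1<x) ⟨
  a * f x            ∎
  where open ≡-Reasoning

f-prime^ : ∀ {q} c → Prime q → f (q ^ suc c) ≡ (q ∸ 1) * q ^ c
f-prime^ {q} c qP = begin
  f (q ^ suc c)              ≡⟨ f≡∸d (1<prime^[1+c] c qP) ⟩
  q * q ^ c ∸ d (q ^ suc c)  ≡⟨ cong (q * q ^ c ∸_) (d-prime^ c qP) ⟩
  q * q ^ c ∸ q ^ c          ≡⟨ cong (q * q ^ c ∸_) (ℕ.*-identityˡ (q ^ c)) ⟨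
  q * q ^ c ∸ 1 * q ^ c      ≡⟨ ℕ.*-distribʳ-∸ (q ^ c) q 1 ⟨
  (q ∸ 1) * q ^ c            ∎
  where open ≡-Reasoning

f-≤ : ∀ y → f y ≤ y
f-≤ y with prime? y
... | yes _ = ℕ.m∸n≤m y 1
... | no _  = ℕ.m∸n≤m y (d y)

f-< : ∀ {y} → 1 < y → f y < y
f-< {y} 1<y = subst (_< y) (sym (f≡∸d 1<y))
  (ℕ.∸-monoʳ-< {o = 0} (ℕ.>-nonZero⁻¹ (d y) {{d-nonZero 1<y}}) (ℕ.<⇒≤ (r<y (d-largestProperDivisor 1<y))))

iter-antitone : ∀ x {i j} → i ≤ j → iter j x ≤ iter i x
iter-antitone x {j = zero}  z≤n = ℕ.≤-refl
iter-antitone x {j = suc j} i≤1+j with ℕ.m≤n⇒m<n∨m≡n i≤1+j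
... | inj₁ (s≤s i≤j) = ℕ.≤-trans (f-≤ (iter j x)) (iter-antitone x i≤j)
... | inj₂ refl      = ℕ.≤-refl

iter-∈F : ∀ x i → 1 < iter i x → iter (suc i) x ∈F x
iter-∈F x i 1<xᵢ = suc i , refl , λ j j<1+i → ℕ.<-≤-trans 1<xᵢ (iter-antitone x (ℕ.≤-pred j<1+i))

-- Removing the largest prime

PseudoperfectIdentity : ℕ → Set
PseudoperfectIdentity n = primePowerRecipSum n + inv n ≡ 1ℚ

OrbitIsDivisors : ℕ → Set
OrbitIsDivisors n = ∀ z → (z ∈F n) ⇔ (z ∣ n)

module StripLargestPrime {q c m : ℕ} .{{_ : NonZero m}} (q-prime : Prime q) (q∤m : ¬ q ∣ m)
                         (q-largest : ∀ {p} → Prime p → p ∣ q ^ suc c * m → p ≤ q)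
                         (orbit : OrbitIsDivisors (q ^ suc c * m)) where

  Q = q ^ suc c
  n = Q * m

  instance
    _ = prime⇒nonZero q-prime
    _ = ℕ.m^n≢0 q c
    _ = ℕ.m^n≢0 q (suc c)

  1<Q : 1 < Q
  1<Q = 1<prime^[1+c] c q-prime

  ∈F⇒∣ : ∀ {z} → z ∈F n → z ∣ n
  ∈F⇒∣ {z} = Equivalence.to (orbit z)

  ∣⇒∈F : ∀ {z} → z ∣ n → z ∈F n
  ∣⇒∈F {z} = Equivalence.from (orbit z)

  orbit-scaled : ∀ i → (∀ j → j < i → 1 < iter j m) → iter i n ≡ Q * iter i m × iter i m ∣ m
  orbit-scaled zero    _     = refl , ∣-refl
  orbit-scaled (suc i) above with orbit-scaled i (λ j j<i → above j (ℕ.m<n⇒m<1+n j<i))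
  ... | nᵢ≡Q*mᵢ , mᵢ∣m =
    nᵢ₊₁≡Q*mᵢ₊₁ , *-cancelˡ-∣ Q (subst (_∣ n) nᵢ₊₁≡Q*mᵢ₊₁ (∈F⇒∣ nᵢ₊₁∈F))
    where
    mᵢ = iter i m
    1<mᵢ : 1 < mᵢ
    1<mᵢ = above i (ℕ.n<1+n i)
    primes-ordered : PrimeFactorsBelow mᵢ Q
    primes-ordered pP sP p∣Q s∣mᵢ with prime∣prime^⇒≡ (suc c) pP q-prime p∣Q
    ... | refl = q-largest sP (∣-trans s∣mᵢ (∣-trans mᵢ∣m (n∣m*n Q)))
    nᵢ₊₁≡Q*mᵢ₊₁ : iter (suc i) n ≡ Q * iter (suc i) m
    nᵢ₊₁≡Q*mᵢ₊₁ = trans (cong f nᵢ≡Q*mᵢ) (f-* Q 1<mᵢ primes-ordered)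
    nᵢ₊₁∈F : iter (suc i) n ∈F n
    nᵢ₊₁∈F = iter-∈F n i (subst (1 <_) (sym nᵢ≡Q*mᵢ) (ℕ.<-≤-trans 1<mᵢ (ℕ.m≤n*m mᵢ Q)))

  -- If the orbit of m hit 1 at step j, the orbit of n would be at Q there and below Q afterwards.
  m-orbit-above-1 : ∀ {i} → Q ≤ iter i n → ∀ j → j < i → 1 < iter j m
  m-orbit-above-1 {i} Q≤nᵢ = <-rec (λ j → j < i → 1 < iter j m) step
    where
    step : ∀ j → (∀ {k} → k < j → k < i → 1 < iter k m) → j < i → 1 < iter j m
    step j below j<i with orbit-scaled j (λ k k<j → below k<j (ℕ.<-trans k<j j<i))
    ... | nⱼ≡Q*mⱼ , mⱼ∣m = ℕ.≤∧≢⇒< (ℕ.>-nonZero⁻¹ _ {{∣⇒nonZero mⱼ∣m}}) 1≢mⱼ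
      where
      1≢mⱼ : 1 ≢ iter j m
      1≢mⱼ 1≡mⱼ = ℕ.<⇒≱ (begin-strict
        iter i n        ≤⟨ iter-antitone n j<i ⟩
        iter (suc j) n  ≡⟨ cong f (trans nⱼ≡Q*mⱼ (trans (cong (Q *_) (sym 1≡mⱼ)) (ℕ.*-identityʳ Q))) ⟩
        f Q             <⟨ f-< 1<Q ⟩
        Q               ∎) Q≤nᵢ
        where open ℕ.≤-Reasoning

  orbit-m : OrbitIsDivisors m
  orbit-m z = mk⇔ ∈F⇒∣m ∣m⇒∈F
    where
    ∈F⇒∣m : z ∈F m → z ∣ m
    ∈F⇒∣m (i , mᵢ≡z , above) = subst (_∣ m) mᵢ≡z (proj₂ (orbit-scaled i above))
    ∣m⇒∈F : z ∣ m → z ∈F m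
    ∣m⇒∈F z∣m with ∣⇒∈F (*-monoʳ-∣ Q z∣m)
    ... | i , nᵢ≡Qz , _ = i , ℕ.*-cancelˡ-≡ _ _ Q (trans (sym (proj₁ (orbit-scaled i above))) nᵢ≡Qz) , above
      where
      above = m-orbit-above-1 (subst (Q ≤_) (sym nᵢ≡Qz) (ℕ.m≤m*n Q z {{∣⇒nonZero z∣m}}))

  -- (q-1)·q^c = f Q follows Q in the orbit, so it divides n, whence q-1 ∣ m.  Conversely q^c·m
  -- divides n, so it lies on the orbit; it cannot be Q·(an iterate of m) since q ∤ m, so it comes
  -- after Q and is at most (q-1)·q^c.
  q≡1+m : q ≡ suc m
  q≡1+m with Equivalence.from (orbit-m 1) (1∣ m)
  ... | i₀ , mᵢ₀≡1 , above₀ = trans (sym (ℕ.suc-pred q)) (cong suc (ℕ.≤-antisym q-1≤m m≤q-1))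
    where
    open ℕ.≤-Reasoning
    nᵢ₀≡Q : iter i₀ n ≡ Q
    nᵢ₀≡Q = trans (proj₁ (orbit-scaled i₀ above₀)) (trans (cong (Q *_) mᵢ₀≡1) (ℕ.*-identityʳ Q))
    nᵢ₀₊₁≡[q-1]*q^c : iter (suc i₀) n ≡ (q ∸ 1) * q ^ c
    nᵢ₀₊₁≡[q-1]*q^c = trans (cong f nᵢ₀≡Q) (f-prime^ c q-prime)
    q-1≤m : q ∸ 1 ≤ m
    q-1≤m = ∣⇒≤ (∣m+n∣m⇒∣n (subst (q ∸ 1 ∣_) qm≡[q-1]m+m q-1∣qm) (m∣m*n m))
      where
      q-1∣qm : q ∸ 1 ∣ q * m
      q-1∣qm = *-cancelʳ-∣ (q ^ c) (subst₂ _∣_ nᵢ₀₊₁≡[q-1]*q^c (ℕ*.xy∙z≈xz∙y q (q ^ c) m)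
                                          (∈F⇒∣ (iter-∈F n i₀ (subst (1 <_) (sym nᵢ₀≡Q) 1<Q))))
      qm≡[q-1]m+m : q * m ≡ (q ∸ 1) * m ℕ.+ m
      qm≡[q-1]m+m = trans (cong (_* m) (sym (ℕ.suc-pred q))) (ℕ.+-comm m _)
    m≤q-1 : m ≤ q ∸ 1
    m≤q-1 with ∣⇒∈F (divides q (ℕ.*-assoc q (q ^ c) m))
    ... | i , nᵢ≡q^c*m , _ with i ℕ.≤? i₀
    ...   | yes i≤i₀ = contradiction (divides (iter i m) m≡mᵢ*q) q∤m
      where
      m≡mᵢ*q : m ≡ iter i m * q
      m≡mᵢ*q = ℕ.*-cancelˡ-≡ _ _ (q ^ c) (begin-equality
        q ^ c * m               ≡⟨ nᵢ≡q^c*m ⟨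
        iter i n                ≡⟨ proj₁ (orbit-scaled i (λ j j<i → above₀ j (ℕ.<-≤-trans j<i i≤i₀))) ⟩
        q * q ^ c * iter i m    ≡⟨ ℕ*.xy∙z≈y∙zx q (q ^ c) (iter i m) ⟩
        q ^ c * (iter i m * q)  ∎)
    ...   | no i≰i₀ = ℕ.*-cancelˡ-≤ (q ^ c) (begin
        q ^ c * m        ≡⟨ nᵢ≡q^c*m ⟨
        iter i n         ≤⟨ iter-antitone n (ℕ.≰⇒> i≰i₀) ⟩
        iter (suc i₀) n  ≡⟨ nᵢ₀₊₁≡[q-1]*q^c ⟩
        (q ∸ 1) * q ^ c  ≡⟨ ℕ.*-comm (q ∸ 1) (q ^ c) ⟩
        q ^ c * (q ∸ 1)  ∎)

  pseudoperfect-lift : PseudoperfectIdentity m → PseudoperfectIdentity n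
  pseudoperfect-lift m-pseudoperfect = begin
    primePowerRecipSum (Q * m) + inv n
      ≡⟨ cong (_+ inv n) (primePowerRecipSum-* Q m (prime^-coprime (suc c) q-prime q∤m)) ⟩
    (primePowerRecipSum Q + primePowerRecipSum m) + inv n
      ≡⟨ ℚ+.xy∙z≈y∙xz (primePowerRecipSum Q) (primePowerRecipSum m) (inv n) ⟩
    primePowerRecipSum m + (primePowerRecipSum Q + inv n)
      ≡⟨ cong (λ x → primePowerRecipSum m + (x + inv n)) (primePowerRecipSum-prime^ (suc c) q-prime) ⟩
    primePowerRecipSum m + (∑[ k < suc c ] inv (q ^ suc k) + inv n)
      ≡⟨ cong (primePowerRecipSum m +_) geometric ⟩
    primePowerRecipSum m + inv m
      ≡⟨ m-pseudoperfect ⟩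
    1ℚ
      ∎
    where
    open ≡-Reasoning
    geometric : ∑[ k < suc c ] inv (q ^ suc k) + inv (q ^ suc c * m) ≡ inv m
    geometric = subst (λ q → ∑[ k < suc c ] inv (q ^ suc k) + inv (q ^ suc c * m) ≡ inv m)
                      (sym q≡1+m) (∑inv-geometric m (suc c))

pseudoperfect : ∀ n .{{_ : NonZero n}} → OrbitIsDivisors n → PseudoperfectIdentity n
pseudoperfect = <-rec (λ n → .{{_ : NonZero n}} → OrbitIsDivisors n → PseudoperfectIdentity n) step
  where
  step : ∀ n → (∀ {k} → k < n → .{{_ : NonZero k}} → OrbitIsDivisors k → PseudoperfectIdentity k) →
         .{{_ : NonZero n}} → OrbitIsDivisors n → PseudoperfectIdentity n
  step (suc zero)      _   _     = refl
  step n@(suc (suc _)) rec orbit with largestPrimeFactor n (s≤s (s≤s z≤n))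
  ... | q , q-prime , q∣n , q-largest with factorOut q-prime n
  ...   | zero  , m , n≡1*m , q∤m = contradiction (subst (q ∣_) (trans n≡1*m (ℕ.*-identityˡ m)) q∣n) q∤m
  ...   | suc c , m , n≡Q*m , q∤m = subst PseudoperfectIdentity (sym n≡Q*m) (pseudoperfect-lift (rec m<n orbit-m))
    where
    instance
      _ : NonZero m
      _ = ∣⇒nonZero (divides (q ^ suc c) n≡Q*m)
    open StripLargestPrime {c = c} q-prime q∤m
           (subst (λ n → ∀ {p} → Prime p → p ∣ n → p ≤ q) n≡Q*m q-largest)
           (subst OrbitIsDivisors n≡Q*m orbit)
      using (Q; 1<Q; orbit-m; pseudoperfect-lift)
    m<n : m < n
    m<n = subst (m <_) (trans (ℕ.*-comm m Q) (sym n≡Q*m)) (ℕ.m<m*n m Q 1<Q)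

theorem3 : (n : ℕ) → 1 < n → (∀ m → (m ∈F n) ⇔ (m ∣ n)) → PPPseudoperfect n
theorem3 n 1<n orbit = 1<n , pseudoperfect n {{1<⇒nonZero 1<n}} orbit
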